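{- For all DIBI formulas $P,Q$: $P\vdash Q$ is derivable in the DIBI Hilbert system if and only if $[\![P]\!]\le[\![Q]\!]$ for every DIBI algebra $\mathbb{A}$ and every algebraic interpretation $[\![-]\!]$ into $\mathbb{A}$.
   Context: DIBI formulas over atoms $\mathcal{AP}$: $P,Q ::= p \mid \top \mid I \mid \bot \mid P\wedge Q \mid P\vee Q \mid P\to Q \mid P * Q \mid P \mathrel{ -\!\!*} Q \mid P \triangleright Q \mid P \multimap_r Q \mid P \multimap_l Q$. A DIBI algebra is $\mathbb{A}=(A,\wedge,\vee,\to,\top,\bot,*,\mathrel{ -\!\!*},\triangleright,\multimap_r,\multimap_l,I)$ such that for all $a,b,c,d\in A$: $(A,\wedge,\vee,\to,\top,\bot)$ is a Heyting algebra (order $\le$); $(A,*,I)$ is a commutative monoid; $\triangleright$ is associative with right unit $I$ and $a\le I\triangleright a$; $a*b\le c$ iff $a\le b\mathrel{ -\!\!*}c$; $a\triangleright b\le c$ iff $a\le b\multimap_r c$ iff $b\le a\multimap_l c$; $(a\triangleright b)*(c\triangleright d)\le(a*c)\triangleright(b*d)$. An algebraic interpretation is the unique homomorphic extension to all formulas of an assignment $\mathcal{AP}\to A$ (each connective interpreted by the same-named operation). The DIBI Hilbert system derives sequents $P\vdash Q$ by the rules (premises $\Rightarrow$ conclusion): $P\vdash P$; $P\vdash\top$; $\bot\vdash P$; $P\vdash R, Q\vdash R\Rightarrow P\vee Q\vdash R$; $P\vdash Q_i\Rightarrow P\vdash Q_1\vee Q_2$; $P\vdash Q, P\vdash R\Rightarrow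 P\vdash Q\wedge R$; $Q\vdash R\Rightarrow P\wedge Q\vdash R$; $P\vdash Q_1\wedge Q_2\Rightarrow P\vdash Q_i$; $P\wedge Q\vdash R\Rightarrow P\vdash Q\to R$; $P\vdash Q\to R, P\vdash Q\Rightarrow P\vdash R$; $P*Q\vdash R\Rightarrow P\vdash Q\mathrel{ -\!\!*}R$; $P\vdash Q\mathrel{ -\!\!*}R, S\vdash Q\Rightarrow P*S\vdash R$; $P\triangleright Q\vdash R\Rightarrow P\vdash Q\multimap_r R$; $P\vdash Q\multimap_r R, S\vdash Q\Rightarrow P\triangleright S\vdash R$; $P\triangleright Q\vdash R\Rightarrow Q\vdash P\multimap_l R$; $P\vdash Q\multimap_l R, S\vdash Q\Rightarrow S\triangleright P\vdash R$; $P\vdash P*I$, $P*I\vdash P$; $P\vdash R, Q\vdash S\Rightarrow P*Q\vdash R*S$; $P*Q\vdash Q*P$; $(P*Q)*R\vdash P*(Q*R)$ and converse; $P\vdash I\triangleright P$; $P\vdash R, Q\vdash S\Rightarrow P\triangleright Q\vdash R\triangleright S$; $P\vdash P\triangleright I$, $P\triangleright I\vdash P$; $(P\triangleright Q)\triangleright R\vdash P\triangleright(Q\triangleright R)$ and converse; $(P\triangleright Q)*(R\triangleright S)\vdash(P*R)\triangleright(Q*S)$. -}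

module Defs where

open import Level using (Level; _⊔_; suc)
open import Relation.Binary.Lattice.Bundles using (HeytingAlgebra)
open import Algebra.Structures using (IsCommutativeMonoid)
open import Function.Bundles using (_⇔_)

module Syntax {a : Level} (AP : Set a) where

  infixr 5 _⇒_
  infixr 6 _∨_
  infixr 7 _∧_
  infixr 8 _∗_ _─∗_ _▷_ _⊸r_ _⊸l_

  data Fm : Set a where
    atom : AP → Fm
    ⊤ I ⊥ : Fm
    _∧_ _∨_ _⇒_ _∗_ _─∗_ _▷_ _⊸r_ _⊸l_ : Fm → Fm → Fm

  infix 4 _⊢_

  data _⊢_ : Fm → Fm → Set a where
    ax      : ∀ {P} → P ⊢ P
    ⊤-I     : ∀ {P} → P ⊢ ⊤
    ⊥-E     : ∀ {P} → ⊥ ⊢ P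
    ∨-E     : ∀ {P Q R} → P ⊢ R → Q ⊢ R → P ∨ Q ⊢ R
    ∨-I₁    : ∀ {P Q₁ Q₂} → P ⊢ Q₁ → P ⊢ Q₁ ∨ Q₂
    ∨-I₂    : ∀ {P Q₁ Q₂} → P ⊢ Q₂ → P ⊢ Q₁ ∨ Q₂
    ∧-I     : ∀ {P Q R} → P ⊢ Q → P ⊢ R → P ⊢ Q ∧ R
    ∧-W     : ∀ {P Q R} → Q ⊢ R → P ∧ Q ⊢ R
    ∧-E₁    : ∀ {P Q₁ Q₂} → P ⊢ Q₁ ∧ Q₂ → P ⊢ Q₁
    ∧-E₂    : ∀ {P Q₁ Q₂} → P ⊢ Q₁ ∧ Q₂ → P ⊢ Q₂
    ⇒-I     : ∀ {P Q R} → P ∧ Q ⊢ R → P ⊢ Q ⇒ R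
    ⇒-E     : ∀ {P Q R} → P ⊢ Q ⇒ R → P ⊢ Q → P ⊢ R
    ─∗-I    : ∀ {P Q R} → P ∗ Q ⊢ R → P ⊢ Q ─∗ R
    ─∗-E    : ∀ {P Q R S} → P ⊢ Q ─∗ R → S ⊢ Q → P ∗ S ⊢ R
    ⊸r-I    : ∀ {P Q R} → P ▷ Q ⊢ R → P ⊢ Q ⊸r R
    ⊸r-E    : ∀ {P Q R S} → P ⊢ Q ⊸r R → S ⊢ Q → P ▷ S ⊢ R
    ⊸l-I    : ∀ {P Q R} → P ▷ Q ⊢ R → Q ⊢ P ⊸l R
    ⊸l-E    : ∀ {P Q R S} → P ⊢ Q ⊸l R → S ⊢ Q → S ▷ P ⊢ R
    ∗-unit₁ : ∀ {P} → P ⊢ P ∗ I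
    ∗-unit₂ : ∀ {P} → P ∗ I ⊢ P
    ∗-conj  : ∀ {P Q R S} → P ⊢ R → Q ⊢ S → P ∗ Q ⊢ R ∗ S
    ∗-comm  : ∀ {P Q} → P ∗ Q ⊢ Q ∗ P
    ∗-assoc₁ : ∀ {P Q R} → (P ∗ Q) ∗ R ⊢ P ∗ (Q ∗ R)
    ∗-assoc₂ : ∀ {P Q R} → P ∗ (Q ∗ R) ⊢ (P ∗ Q) ∗ R
    ▷-unitL : ∀ {P} → P ⊢ I ▷ P
    ▷-conj  : ∀ {P Q R S} → P ⊢ R → Q ⊢ S → P ▷ Q ⊢ R ▷ S
    ▷-unitR₁ : ∀ {P} → P ⊢ P ▷ I
    ▷-unitR₂ : ∀ {P} → P ▷ I ⊢ P
    ▷-assoc₁ : ∀ {P Q R} → (P ▷ Q) ▷ R ⊢ P ▷ (Q ▷ R)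
    ▷-assoc₂ : ∀ {P Q R} → P ▷ (Q ▷ R) ⊢ (P ▷ Q) ▷ R
    rev-exch : ∀ {P Q R S} → (P ▷ Q) ∗ (R ▷ S) ⊢ (P ∗ R) ▷ (Q ∗ S)

record DIBIAlgebra (c ℓ₁ ℓ₂ : Level) : Set (suc (c ⊔ ℓ₁ ⊔ ℓ₂)) where
  field
    heyting : HeytingAlgebra c ℓ₁ ℓ₂
  open HeytingAlgebra heyting public
  infixr 8 _∗_ _─∗_ _▷_ _⊸r_ _⊸l_
  field
    _∗_ _─∗_ _▷_ _⊸r_ _⊸l_ : Carrier → Carrier → Carrier
    I : Carrier
    ∗-isCommutativeMonoid : IsCommutativeMonoid _≈_ _∗_ I
    ▷-assoc   : ∀ x y z → ((x ▷ y) ▷ z) ≈ (x ▷ (y ▷ z))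
    ▷-identityʳ : ∀ x → (x ▷ I) ≈ x
    ▷-unitˡ-≤ : ∀ x → x ≤ (I ▷ x)
    ─∗-residual : ∀ x y z → ((x ∗ y) ≤ z) ⇔ (x ≤ (y ─∗ z))
    ⊸r-residual : ∀ x y z → ((x ▷ y) ≤ z) ⇔ (x ≤ (y ⊸r z))
    ⊸l-residual : ∀ x y z → ((x ▷ y) ≤ z) ⇔ (y ≤ (x ⊸l z))
    reverse-exchange : ∀ x y z w → ((x ▷ y) ∗ (z ▷ w)) ≤ ((x ∗ z) ▷ (y ∗ w))

module _ {a c ℓ₁ ℓ₂ : Level} {AP : Set a} (𝔸 : DIBIAlgebra c ℓ₁ ℓ₂) where
  open Syntax AP
  private module A = DIBIAlgebra 𝔸

  ⟦_⟧ : Fm → (AP → A.Carrier) → A.Carrier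
  ⟦ atom p ⟧ v = v p
  ⟦ ⊤ ⟧ v = A.⊤
  ⟦ I ⟧ v = A.I
  ⟦ ⊥ ⟧ v = A.⊥
  ⟦ P ∧ Q ⟧ v = ⟦ P ⟧ v A.∧ ⟦ Q ⟧ v
  ⟦ P ∨ Q ⟧ v = ⟦ P ⟧ v A.∨ ⟦ Q ⟧ v
  ⟦ P ⇒ Q ⟧ v = ⟦ P ⟧ v A.⇨ ⟦ Q ⟧ v
  ⟦ P ∗ Q ⟧ v = ⟦ P ⟧ v A.∗ ⟦ Q ⟧ v
  ⟦ P ─∗ Q ⟧ v = ⟦ P ⟧ v A.─∗ ⟦ Q ⟧ v
  ⟦ P ▷ Q ⟧ v = ⟦ P ⟧ v A.▷ ⟦ Q ⟧ v
  ⟦ P ⊸r Q ⟧ v = ⟦ P ⟧ v A.⊸r ⟦ Q ⟧ v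
  ⟦ P ⊸l Q ⟧ v = ⟦ P ⟧ v A.⊸l ⟦ Q ⟧ v

-- Soundness is an induction on derivations; the only algebraic facts not
-- literally among the axioms are monotonicity of ∗ and ▷, which follow from
-- their residuals. Completeness uses the Lindenbaum–Tarski algebra: formulas
-- ordered by derivability form a DIBI algebra in which the valuation
-- p ↦ atom p interprets every formula as itself.
module Submission where

open import Defs
open import Level using (Level)
open import Function.Bundles using (_⇔_; mk⇔; module Equivalence)
open import Data.Product using (_×_; _,_; proj₁)
open import Relation.Binary.Structures using (IsEquivalence)
open import Relation.Binary.Lattice.Bundles using (HeytingAlgebra)
open import Algebra.Structures using (IsCommutativeMonoid)
open import Algebra.Structures.Biased using (isCommutativeMonoidʳ)

module DIBIAlgebraProperties {c ℓ₁ ℓ₂ : Level} (𝔸 : DIBIAlgebra c ℓ₁ ℓ₂) where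
  open DIBIAlgebra 𝔸
  open Equivalence using (to; from)
  private module ∗ = IsCommutativeMonoid ∗-isCommutativeMonoid

  ∗-monoˡ-≤ : ∀ {x y} z → x ≤ y → (x ∗ z) ≤ (y ∗ z)
  ∗-monoˡ-≤ {x} {y} z x≤y =
    from (─∗-residual x z (y ∗ z)) (trans x≤y (to (─∗-residual y z (y ∗ z)) refl))

  ∗-mono-≤ : ∀ {x y z w} → x ≤ y → z ≤ w → (x ∗ z) ≤ (y ∗ w)
  ∗-mono-≤ {x} {y} {z} {w} x≤y z≤w =
    trans (∗-monoˡ-≤ z x≤y)
      (trans (reflexive (∗.comm y z))
        (trans (∗-monoˡ-≤ y z≤w) (reflexive (∗.comm w y))))

  ▷-monoˡ-≤ : ∀ {x y} z → x ≤ y → (x ▷ z) ≤ (y ▷ z)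
  ▷-monoˡ-≤ {x} {y} z x≤y =
    from (⊸r-residual x z (y ▷ z)) (trans x≤y (to (⊸r-residual y z (y ▷ z)) refl))

  ▷-monoʳ-≤ : ∀ x {y z} → y ≤ z → (x ▷ y) ≤ (x ▷ z)
  ▷-monoʳ-≤ x {y} {z} y≤z =
    from (⊸l-residual x y (x ▷ z)) (trans y≤z (to (⊸l-residual x z (x ▷ z)) refl))

  ▷-mono-≤ : ∀ {x y z w} → x ≤ y → z ≤ w → (x ▷ z) ≤ (y ▷ w)
  ▷-mono-≤ {y = y} {z = z} x≤y z≤w = trans (▷-monoˡ-≤ z x≤y) (▷-monoʳ-≤ y z≤w)

module Soundness {a c ℓ₁ ℓ₂ : Level} {AP : Set a}
                 (𝔸 : DIBIAlgebra c ℓ₁ ℓ₂) (v : AP → DIBIAlgebra.Carrier 𝔸) where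
  open Syntax AP
  open DIBIAlgebra 𝔸 using (_≤_; refl; reflexive; trans; maximum; minimum;
    ∨-least; x≤x∨y; y≤x∨y; ∧-greatest; x∧y≤x; x∧y≤y; transpose-⇨; transpose-∧;
    ∗-isCommutativeMonoid; ▷-assoc; ▷-identityʳ; ▷-unitˡ-≤;
    ─∗-residual; ⊸r-residual; ⊸l-residual; reverse-exchange; module Eq)
  open DIBIAlgebraProperties 𝔸
  open Equivalence using (to; from)
  private module ∗ = IsCommutativeMonoid ∗-isCommutativeMonoid

  private
    ⟦_⟧ᵥ : Fm → DIBIAlgebra.Carrier 𝔸
    ⟦ P ⟧ᵥ = ⟦ 𝔸 ⟧ P v

    reflexive˘ : ∀ {x y} → DIBIAlgebra._≈_ 𝔸 x y → y ≤ x
    reflexive˘ x≈y = reflexive (Eq.sym x≈y)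

  sound : ∀ {P Q} → P ⊢ Q → ⟦ P ⟧ᵥ ≤ ⟦ Q ⟧ᵥ
  sound ax          = refl
  sound ⊤-I         = maximum _
  sound ⊥-E         = minimum _
  sound (∨-E p q)   = ∨-least (sound p) (sound q)
  sound (∨-I₁ p)    = trans (sound p) (x≤x∨y _ _)
  sound (∨-I₂ p)    = trans (sound p) (y≤x∨y _ _)
  sound (∧-I p q)   = ∧-greatest (sound p) (sound q)
  sound (∧-W p)     = trans (x∧y≤y _ _) (sound p)
  sound (∧-E₁ p)    = trans (sound p) (x∧y≤x _ _)
  sound (∧-E₂ p)    = trans (sound p) (x∧y≤y _ _)
  sound (⇒-I p)     = transpose-⇨ (sound p)
  sound (⇒-E p q)   = trans (∧-greatest refl (sound q)) (transpose-∧ (sound p))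
  sound (─∗-I p)    = to (─∗-residual _ _ _) (sound p)
  sound (─∗-E p q)  = trans (∗-mono-≤ refl (sound q)) (from (─∗-residual _ _ _) (sound p))
  sound (⊸r-I p)    = to (⊸r-residual _ _ _) (sound p)
  sound (⊸r-E p q)  = trans (▷-mono-≤ refl (sound q)) (from (⊸r-residual _ _ _) (sound p))
  sound (⊸l-I p)    = to (⊸l-residual _ _ _) (sound p)
  sound (⊸l-E p q)  = trans (▷-mono-≤ (sound q) refl) (from (⊸l-residual _ _ _) (sound p))
  sound ∗-unit₁     = reflexive˘ (∗.identityʳ _)
  sound ∗-unit₂     = reflexive (∗.identityʳ _)
  sound (∗-conj p q) = ∗-mono-≤ (sound p) (sound q)
  sound ∗-comm      = reflexive (∗.comm _ _)
  sound ∗-assoc₁    = reflexive (∗.assoc _ _ _)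
  sound ∗-assoc₂    = reflexive˘ (∗.assoc _ _ _)
  sound ▷-unitL     = ▷-unitˡ-≤ _
  sound (▷-conj p q) = ▷-mono-≤ (sound p) (sound q)
  sound ▷-unitR₁    = reflexive˘ (▷-identityʳ _)
  sound ▷-unitR₂    = reflexive (▷-identityʳ _)
  sound ▷-assoc₁    = reflexive (▷-assoc _ _ _)
  sound ▷-assoc₂    = reflexive˘ (▷-assoc _ _ _)
  sound rev-exch    = reverse-exchange _ _ _ _

module LindenbaumTarski {a : Level} (AP : Set a) where
  open Syntax AP
  open import Relation.Binary.PropositionalEquality using (_≡_; refl; cong₂; subst₂)

  ⊢-trans : ∀ {P Q R} → P ⊢ Q → Q ⊢ R → P ⊢ R
  ⊢-trans P⊢Q Q⊢R = ⇒-E (⇒-I (∧-W Q⊢R)) P⊢Q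

  _⊣⊢_ : Fm → Fm → Set a
  P ⊣⊢ Q = (P ⊢ Q) × (Q ⊢ P)

  ⊣⊢-isEquivalence : IsEquivalence _⊣⊢_
  ⊣⊢-isEquivalence = record
    { refl  = ax , ax
    ; sym   = λ (p , q) → q , p
    ; trans = λ (p , q) (r , s) → ⊢-trans p r , ⊢-trans s q
    }

  heytingAlgebra : HeytingAlgebra a a a
  heytingAlgebra = record
    { Carrier = Fm ; _≈_ = _⊣⊢_ ; _≤_ = _⊢_
    ; _∨_ = _∨_ ; _∧_ = _∧_ ; _⇨_ = _⇒_ ; ⊤ = ⊤ ; ⊥ = ⊥
    ; isHeytingAlgebra = record
      { isBoundedLattice = record
        { isLattice = record
          { isPartialOrder = record
            { isPreorder = record
              { isEquivalence = ⊣⊢-isEquivalence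
              ; reflexive     = proj₁
              ; trans         = ⊢-trans
              }
            ; antisym = _,_
            }
          ; supremum = λ _ _ → ∨-I₁ ax , ∨-I₂ ax , λ _ → ∨-E
          ; infimum  = λ _ _ → ∧-E₁ ax , ∧-E₂ ax , λ _ → ∧-I
          }
        ; maximum = λ _ → ⊤-I
        ; minimum = λ _ → ⊥-E
        }
      ; exponential = λ _ _ _ → ⇒-I , λ p → ⇒-E (⊢-trans (∧-E₁ ax) p) (∧-E₂ ax)
      }
    }

  dibiAlgebra : DIBIAlgebra a a a
  dibiAlgebra = record
    { heyting = heytingAlgebra
    ; _∗_ = _∗_ ; _─∗_ = _─∗_ ; _▷_ = _▷_ ; _⊸r_ = _⊸r_ ; _⊸l_ = _⊸l_ ; I = I
    ; ∗-isCommutativeMonoid = isCommutativeMonoidʳ record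
      { isSemigroup = record
        { isMagma = record
          { isEquivalence = ⊣⊢-isEquivalence
          ; ∙-cong        = λ (p , q) (r , s) → ∗-conj p r , ∗-conj q s
          }
        ; assoc = λ _ _ _ → ∗-assoc₁ , ∗-assoc₂
        }
      ; identityʳ = λ _ → ∗-unit₂ , ∗-unit₁
      ; comm      = λ _ _ → ∗-comm , ∗-comm
      }
    ; ▷-assoc          = λ _ _ _ → ▷-assoc₁ , ▷-assoc₂
    ; ▷-identityʳ      = λ _ → ▷-unitR₂ , ▷-unitR₁
    ; ▷-unitˡ-≤        = λ _ → ▷-unitL
    ; ─∗-residual      = λ _ _ _ → mk⇔ ─∗-I (λ p → ─∗-E p ax)
    ; ⊸r-residual      = λ _ _ _ → mk⇔ ⊸r-I (λ p → ⊸r-E p ax)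
    ; ⊸l-residual      = λ _ _ _ → mk⇔ ⊸l-I (λ p → ⊸l-E p ax)
    ; reverse-exchange = λ _ _ _ _ → rev-exch
    }

  ⟦⟧-atom : ∀ P → ⟦ dibiAlgebra ⟧ P atom ≡ P
  ⟦⟧-atom (atom p) = refl
  ⟦⟧-atom ⊤        = refl
  ⟦⟧-atom I        = refl
  ⟦⟧-atom ⊥        = refl
  ⟦⟧-atom (P ∧ Q)  = cong₂ _∧_ (⟦⟧-atom P) (⟦⟧-atom Q)
  ⟦⟧-atom (P ∨ Q)  = cong₂ _∨_ (⟦⟧-atom P) (⟦⟧-atom Q)
  ⟦⟧-atom (P ⇒ Q)  = cong₂ _⇒_ (⟦⟧-atom P) (⟦⟧-atom Q)
  ⟦⟧-atom (P ∗ Q)  = cong₂ _∗_ (⟦⟧-atom P) (⟦⟧-atom Q)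
  ⟦⟧-atom (P ─∗ Q) = cong₂ _─∗_ (⟦⟧-atom P) (⟦⟧-atom Q)
  ⟦⟧-atom (P ▷ Q)  = cong₂ _▷_ (⟦⟧-atom P) (⟦⟧-atom Q)
  ⟦⟧-atom (P ⊸r Q) = cong₂ _⊸r_ (⟦⟧-atom P) (⟦⟧-atom Q)
  ⟦⟧-atom (P ⊸l Q) = cong₂ _⊸l_ (⟦⟧-atom P) (⟦⟧-atom Q)

  complete : ∀ {P Q} → ⟦ dibiAlgebra ⟧ P atom ⊢ ⟦ dibiAlgebra ⟧ Q atom → P ⊢ Q
  complete {P} {Q} = subst₂ _⊢_ (⟦⟧-atom P) (⟦⟧-atom Q)

mainTheorem2 : {a : Level} (AP : Set a) (P Q : Syntax.Fm AP) →
    Syntax._⊢_ AP P Q ⇔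
      ((𝔸 : DIBIAlgebra a a a) (v : AP → DIBIAlgebra.Carrier 𝔸) →
        DIBIAlgebra._≤_ 𝔸 (⟦_⟧ 𝔸 P v) (⟦_⟧ 𝔸 Q v))
mainTheorem2 AP P Q = mk⇔
  (λ P⊢Q 𝔸 v → Soundness.sound 𝔸 v P⊢Q)
  (λ valid → LindenbaumTarski.complete AP (valid (LindenbaumTarski.dibiAlgebra AP) (Syntax.atom)))
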